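{- For every positive integer $m$, the complete bipartite graph $K_{2,m}$ is locatable.
   Context: The robber-locating game on a finite connected simple graph $G$: a robber occupies an unknown vertex. In each round the cop probes any vertex $p$ of $G$ (no restriction), and the robber truthfully announces the graph distance from his current vertex to $p$. If the information gathered so far determines the robber's current vertex uniquely, the cop wins. Otherwise the robber moves to an adjacent vertex or stays put, with the no-backtrack condition: he may not move to the vertex $p$ just probed. The robber is omniscient. $G$ is locatable if the cop has a strategy guaranteed to determine the robber's vertex after finitely many probes, and non-locatable otherwise. -}

module Defs where

open import Data.Nat using (ℕ; zero; suc; _≤_; _<ᵇ_)
open import Data.Fin using (Fin; toℕ)
open import Data.Bool using (Bool)
open import Data.Product using (Σ; ∃; _×_; _,_)
open import Data.Sum using (_⊎_)
open import Data.Empty using (⊥)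
open import Relation.Nullary using (¬_)
open import Relation.Binary.PropositionalEquality using (_≡_; refl; sym)
open import Level using (0ℓ) renaming (suc to lsuc)

record SimpleGraph (n : ℕ) : Set₁ where
  field
    Adj      : Fin n → Fin n → Set
    sym-adj  : ∀ {u v} → Adj u v → Adj v u
    irrefl   : ∀ {u} → ¬ Adj u u

open SimpleGraph public

data Walk {n : ℕ} (G : SimpleGraph n) : Fin n → Fin n → ℕ → Set where
  here : ∀ {u} → Walk G u u zero
  step : ∀ {u v w k} → Adj G u v → Walk G v w k → Walk G u w (suc k)

IsDist : ∀ {n} → SimpleGraph n → Fin n → Fin n → ℕ → Set
IsDist G u v d = Walk G u v d × (∀ k → Walk G u v k → d ≤ k)

Connected : ∀ {n} → SimpleGraph n → Set
Connected {n} G = ∀ (u v : Fin n) → ∃ λ d → Walk G u v d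

VSet : ℕ → Set₁
VSet n = Fin n → Set

Singleton : ∀ {n} → VSet n → Set
Singleton {n} S = Σ (Fin n) λ v → S v × (∀ w → S w → w ≡ v)

Answer : ∀ {n} → SimpleGraph n → VSet n → Fin n → ℕ → VSet n
Answer G S p d v = S v × IsDist G v p d

-- Possible robber positions after one move (stay or move to a neighbour),
-- never onto the just-probed vertex p (no-backtrack rule).
Move : ∀ {n} → SimpleGraph n → Fin n → VSet n → VSet n
Move {n} G p S w = (Σ (Fin n) λ v → S v × (w ≡ v ⊎ Adj G v w)) × ¬ (w ≡ p)

-- CopWins G S : the cop, knowing only that the robber's current vertex lies
-- in S (the set of positions consistent with all information so far), has a
-- strategy that locates the robber after finitely many further probes.
data CopWins {n : ℕ} (G : SimpleGraph n) : VSet n → Set₁ where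
  probe : ∀ {S} (p : Fin n) →
          (∀ d → (Σ (Fin n) λ v → Answer G S p d v) →
             Singleton (Answer G S p d) ⊎ CopWins G (Move G p (Answer G S p d))) →
          CopWins G S

Locatable : ∀ {n} → SimpleGraph n → Set₁
Locatable G = CopWins G (λ _ → Data.Unit.⊤)
  where import Data.Unit

inA : ∀ {m} → Fin (2 Data.Nat.+ m) → Bool
inA i = toℕ i <ᵇ 2

K2 : (m : ℕ) → SimpleGraph (2 Data.Nat.+ m)
K2 m = record
  { Adj     = λ i j → ¬ (inA i ≡ inA j)
  ; sym-adj = λ h e → h (sym e)
  ; irrefl  = λ h → h refl
  }

module Submission where

-- Write a₀, a₁ for the two vertices of the small side and b₀, …, b_m for the
-- others.  Two kinds of candidate sets occur during the cop's strategy: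
--   S k = {a₀, a₁} ∪ {b_j | j < k}   and   T k = {a₁} ∪ {b_j | j ≤ k}.
-- From S k the cop probes a₀: answers 0 and 2 locate a₀ resp. a₁, and answer
-- 1 means the robber is on some b_j (j < k); he then stays or moves to a₁
-- (a₀ is forbidden), so he is in T (k - 1).  From T k the cop probes b_k:
-- answer 1 locates a₁, answer 0 locates b_k, and answer 2 means he is on some
-- b_j with j < k, from where he reaches S k (b_k is forbidden).  Since
-- S 0 = {a₀, a₁} is located by one probe, induction on k wins from every S k,
-- and S (m + 1) is the whole vertex set.

open import Function using (_∋_)
open import Data.Nat using (ℕ; zero; suc; _≤_; _<_; z≤n; s≤s; _≟_)
open import Data.Nat.Properties using (≤-antisym; ≤-refl; ≤-pred; <⇒≤; m<n⇒0<n; ≤∧≢⇒<)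
open import Data.Fin using (Fin; zero; suc; toℕ; fromℕ<)
open import Data.Fin.Properties using (toℕ-fromℕ<; toℕ-injective; toℕ<n)
open import Data.Product using (Σ; _×_; _,_)
open import Data.Sum using (_⊎_; inj₁; inj₂)
open import Data.Empty using (⊥; ⊥-elim)
open import Data.Unit using (⊤; tt)
open import Relation.Nullary using (¬_; yes; no)
open import Relation.Binary.PropositionalEquality using (_≡_; refl; sym; trans; cong)
open import Defs

module Game {n : ℕ} (G : SimpleGraph n) where

  _⊆_ : VSet n → VSet n → Set
  S ⊆ T = ∀ v → S v → T v

  Move-⊆ : ∀ {p S T} → S ⊆ T → Move G p S ⊆ Move G p T
  Move-⊆ S⊆T w ((v , v∈S , stay-or-move) , w≢p) = (v , S⊆T v v∈S , stay-or-move) , w≢p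

  CopWins-⊆ : ∀ {S T} → S ⊆ T → CopWins G T → CopWins G S
  CopWins-⊆ {S} {T} S⊆T (probe p next) = probe p next′
    where
    Answer-⊆ : ∀ d → Answer G S p d ⊆ Answer G T p d
    Answer-⊆ d v (v∈S , dist) = S⊆T v v∈S , dist

    next′ : ∀ d → Σ (Fin n) (Answer G S p d) →
            Singleton (Answer G S p d) ⊎ CopWins G (Move G p (Answer G S p d))
    next′ d (v , ans) with next d (v , Answer-⊆ d v ans)
    ... | inj₁ (u , _ , only-u) =
          inj₁ (v , ans , λ w ans′ → trans (only-u w (Answer-⊆ d w ans′))
                                           (sym (only-u v (Answer-⊆ d v ans))))
    ... | inj₂ wins = inj₂ (CopWins-⊆ (Move-⊆ (Answer-⊆ d)) wins)

  IsDist-unique : ∀ {u v d e} → IsDist G u v d → IsDist G u v e → d ≡ e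
  IsDist-unique (walk-d , d-min) (walk-e , e-min) = ≤-antisym (d-min _ walk-e) (e-min _ walk-d)

  DistanceTo : Fin n → (Fin n → ℕ) → Set
  DistanceTo p δ = ∀ v → IsDist G v p (δ v)

  Level : VSet n → (Fin n → ℕ) → ℕ → VSet n
  Level S δ d w = S w × δ w ≡ d

  Pinned : VSet n → (Fin n → ℕ) → Fin n → Set
  Pinned S δ v = ∀ w → S w → δ w ≡ δ v → w ≡ v

  probe-by : ∀ {S} p δ → DistanceTo p δ →
             (∀ v → S v → Pinned S δ v ⊎ CopWins G (Move G p (Level S δ (δ v)))) →
             CopWins G S
  probe-by {S} p δ δ-dist decide = probe p next
    where
    answer⇒level : ∀ d → Answer G S p d ⊆ Level S δ d
    answer⇒level d w (w∈S , dist) = w∈S , IsDist-unique (δ-dist w) dist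

    next : ∀ d → Σ (Fin n) (Answer G S p d) →
           Singleton (Answer G S p d) ⊎ CopWins G (Move G p (Answer G S p d))
    next d (v , v∈S , dist) with IsDist-unique (δ-dist v) dist | decide v v∈S
    ... | refl | inj₁ pinned =
          inj₁ (v , (v∈S , dist) , λ w ans → let (w∈S , δw) = answer⇒level d w ans in pinned w w∈S δw)
    ... | refl | inj₂ wins = inj₂ (CopWins-⊆ (Move-⊆ (answer⇒level d)) wins)

  dist-refl : ∀ {u} → IsDist G u u 0
  dist-refl = here , λ _ _ → z≤n

  dist-adj : ∀ {u v} → Adj G u v → IsDist G u v 1
  dist-adj {u} {v} u~v = step u~v here , minimal
    where
    minimal : ∀ k → Walk G u v k → 1 ≤ k
    minimal zero here = ⊥-elim (irrefl G u~v)
    minimal (suc k) _ = s≤s z≤n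

  dist-two : ∀ {u v x} → ¬ u ≡ v → ¬ Adj G u v → Adj G u x → Adj G x v → IsDist G u v 2
  dist-two {u} {v} u≢v u≁v u~x x~v = step u~x (step x~v here) , minimal
    where
    minimal : ∀ k → Walk G u v k → 2 ≤ k
    minimal zero here = ⊥-elim (u≢v refl)
    minimal (suc zero) (step u~v here) = ⊥-elim (u≁v u~v)
    minimal (suc (suc k)) _ = s≤s (s≤s z≤n)

module Strategy (m : ℕ) where

  G : SimpleGraph (suc (suc (suc m)))
  G = K2 (suc m)

  open Game G

  V : Set
  V = Fin (suc (suc (suc m)))

  pattern a₀ = zero
  pattern a₁ = suc zero
  pattern b j = suc (suc j)

  S : ℕ → VSet (suc (suc (suc m)))
  S k a₀ = ⊤
  S k a₁ = ⊤
  S k (b j) = toℕ j < k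

  T : ℕ → VSet (suc (suc (suc m)))
  T k a₀ = ⊥
  T k a₁ = ⊤
  T k (b j) = toℕ j ≤ k

  δ₀ : V → ℕ
  δ₀ a₀ = 0
  δ₀ a₁ = 2
  δ₀ (b _) = 1

  δ₀-dist : DistanceTo a₀ δ₀
  δ₀-dist a₀ = dist-refl
  δ₀-dist a₁ = dist-two {x = b zero} (λ ()) (λ a₁~a₀ → a₁~a₀ refl) (λ ()) (λ ())
  δ₀-dist (b j) = dist-adj (λ ())

  probe-a₀ : ∀ k → (0 < k → CopWins G (Move G a₀ (Level (S k) δ₀ 1))) → CopWins G (S k)
  probe-a₀ k on-b = probe-by a₀ δ₀ δ₀-dist decide
    where
    decide : ∀ v → S k v → Pinned (S k) δ₀ v ⊎ CopWins G (Move G a₀ (Level (S k) δ₀ (δ₀ v)))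
    decide a₀ _ = inj₁ λ { a₀ _ _ → refl ; a₁ _ () ; (b _) _ () }
    decide a₁ _ = inj₁ λ { a₀ _ () ; a₁ _ _ → refl ; (b _) _ () }
    decide (b j) j<k = inj₂ (on-b (m<n⇒0<n j<k))

  after-a₀ : ∀ k → Move G a₀ (Level (S (suc k)) δ₀ 1) ⊆ T k
  after-a₀ k a₀ (_ , a₀≢a₀) = ⊥-elim (a₀≢a₀ refl)
  after-a₀ k a₁ _ = tt
  after-a₀ k (b i) ((_ , (i<1+k , _) , inj₁ refl) , _) = ≤-pred i<1+k
  after-a₀ k (b i) ((a₀ , (_ , ()) , inj₂ _) , _)
  after-a₀ k (b i) ((a₁ , (_ , ()) , inj₂ _) , _)
  after-a₀ k (b i) ((b _ , _ , inj₂ b~b) , _) = ⊥-elim (b~b refl)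

  -- Distances to b_c, where toℕ c = k: a₀ and a₁ are at distance 1, the other
  -- b's at distance 2.
  δb : ℕ → V → ℕ
  δb k a₀ = 1
  δb k a₁ = 1
  δb k (b j) with toℕ j ≟ k
  ... | yes _ = 0
  ... | no _ = 2

  module ProbeB (k : ℕ) (k<1+m : k < suc m) where

    c : Fin (suc m)
    c = fromℕ< k<1+m

    toℕ≡k⇒≡c : ∀ {j} → toℕ j ≡ k → j ≡ c
    toℕ≡k⇒≡c j≡k = toℕ-injective (trans j≡k (sym (toℕ-fromℕ< k<1+m)))

    toℕ≢k⇒b≢bc : ∀ {j} → ¬ toℕ j ≡ k → ¬ (V ∋ b j) ≡ b c
    toℕ≢k⇒b≢bc j≢k refl = j≢k (toℕ-fromℕ< k<1+m)

    δb-dist : DistanceTo (b c) (δb k)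
    δb-dist a₀ = dist-adj (λ ())
    δb-dist a₁ = dist-adj (λ ())
    δb-dist (b j) with toℕ j ≟ k
    ... | yes j≡k rewrite toℕ≡k⇒≡c j≡k = dist-refl
    ... | no j≢k = dist-two {x = a₀} (toℕ≢k⇒b≢bc j≢k) (λ b~b → b~b refl) (λ ()) (λ ())

    answer-0 : ∀ i → δb k (b i) ≡ 0 → i ≡ c
    answer-0 i δ≡0 with toℕ i ≟ k
    answer-0 i refl | yes i≡k = toℕ≡k⇒≡c i≡k
    answer-0 i ()   | no _

    not-answer-1 : ∀ i → ¬ δb k (b i) ≡ 1
    not-answer-1 i with toℕ i ≟ k
    not-answer-1 i | yes _ = λ ()
    not-answer-1 i | no _ = λ ()

    after-b : Move G (b c) (Level (T k) (δb k) 2) ⊆ S k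
    after-b a₀ _ = tt
    after-b a₁ _ = tt
    after-b (b i) ((_ , (i≤k , _) , inj₁ refl) , bi≢bc) =
      ≤∧≢⇒< i≤k (λ i≡k → bi≢bc (cong (λ j → b j) (toℕ≡k⇒≡c i≡k)))
    after-b (b i) ((a₀ , (() , _) , inj₂ _) , _)
    after-b (b i) ((a₁ , (_ , ()) , inj₂ _) , _)
    after-b (b i) ((b _ , _ , inj₂ b~b) , _) = ⊥-elim (b~b refl)

    probe-b : CopWins G (S k) → CopWins G (T k)
    probe-b wins-S = probe-by (b c) (δb k) δb-dist decide
      where
      decide : ∀ v → T k v → Pinned (T k) (δb k) v ⊎ CopWins G (Move G (b c) (Level (T k) (δb k) (δb k v)))
      decide a₁ _ = inj₁ λ { a₁ _ _ → refl ; (b i) _ δ≡1 → ⊥-elim (not-answer-1 i δ≡1) }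
      decide (b j) _ with toℕ j ≟ k
      ... | yes j≡k = inj₁ λ { a₁ _ () ; (b i) _ δ≡0 → cong (λ l → b l) (trans (answer-0 i δ≡0) (sym (toℕ≡k⇒≡c j≡k))) }
      ... | no _ = inj₂ (CopWins-⊆ after-b wins-S)

  wins-S : ∀ k → k ≤ suc m → CopWins G (S k)
  wins-S zero _ = probe-a₀ zero (λ ())
  wins-S (suc k) k<1+m = probe-a₀ (suc k) λ _ →
    CopWins-⊆ (after-a₀ k) (ProbeB.probe-b k k<1+m (wins-S k (<⇒≤ k<1+m)))

  all-in-S : ∀ v → ⊤ → S (suc m) v
  all-in-S a₀ _ = tt
  all-in-S a₁ _ = tt
  all-in-S (b j) _ = toℕ<n j

lemma3p10 : (m : ℕ) → Locatable (K2 (suc m))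
lemma3p10 m = CopWins-⊆ all-in-S (wins-S (suc m) ≤-refl)
  where open Strategy m
        open Game G
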